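{- Let $n\ge 1$ and consider the $n$-vertex Fibonacci graph $FG$ (vertices $1,\dots,n$; edges $(v,v+1)$ labelled $a_v$ for $1\le v\le n-1$ and $(v,v+2)$ labelled $b_v$ for $1\le v\le n-2$). Let $T(n)$ and $P(n)$ be the total number of terms and the number of plus operators in the expression of $FG$ produced by the DLS method. Then: 1. $T(1)=0$, $T(2)=1$, $T(3)=3$, and $T(n)=T(n-2)+T(n-3)+5$ for $n>3$. 2. $P(1)=0$, $P(2)=0$, $P(3)=1$, and $P(n)=P(n-2)+P(n-3)+2$ for $n>3$.
   Context: The DLS method defines subexpressions $E_i$ for $i=n,n-1,\dots,1$: $E_n=1$; $E_{n-1}=a_{n-1}$; $E_{n-2}=a_{n-2}a_{n-1}+b_{n-2}$; and for $i<n-2$, $E_i=(a_ia_{i+1}+b_i)E_{i+2}+a_ib_{i+1}E_{i+3}$ (sums are parenthesized when multiplied). The resulting expression is $E_1$. A factor equal to the constant $1$ is omitted from products, and the constant $1$ is not counted as a term. The total number of terms of an expression is the number of occurrences of edge labels in it, counted with multiplicity; the number of plus operators is the number of occurrences of $+$. -}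

module Defs where

open import Data.Nat using (ℕ; zero; suc; _+_; _∸_)

-- Edge labels of the Fibonacci graph: a v labels (v,v+1), b v labels (v,v+2).
data Label : Set where
  a : ℕ → Label
  b : ℕ → Label

data Expr : Set where
  one  : Expr
  lab  : Label → Expr
  _⊕_  : Expr → Expr → Expr
  _⊗_  : Expr → Expr → Expr

_⊛_ : Expr → Expr → Expr
one ⊛ f = f
e   ⊛ one = e
e   ⊛ f = e ⊗ f

-- dlsE n d  =  E_{n ∸ d}, the DLS subexpression for vertex i = n - d.
dlsE : ℕ → ℕ → Expr
dlsE n zero = one
dlsE n (suc zero) = lab (a (n ∸ 1))
dlsE n (suc (suc zero)) = (lab (a (n ∸ 2)) ⊛ lab (a (n ∸ 1))) ⊕ lab (b (n ∸ 2))
dlsE n (suc (suc (suc d))) =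
  (((lab (a i) ⊛ lab (a (suc i))) ⊕ lab (b i)) ⊛ dlsE n (suc d))
    ⊕ ((lab (a i) ⊛ lab (b (suc i))) ⊛ dlsE n d)
  where
    i : ℕ
    i = n ∸ suc (suc (suc d))

-- The expression of the n-vertex Fibonacci graph: E_1.
dlsExpr : ℕ → Expr
dlsExpr n = dlsE n (n ∸ 1)

-- Number of occurrences of edge labels (the constant 1 is not a term).
terms : Expr → ℕ
terms one = 0
terms (lab _) = 1
terms (e ⊕ f) = terms e + terms f
terms (e ⊗ f) = terms e + terms f

pluses : Expr → ℕ
pluses one = 0
pluses (lab _) = 0
pluses (e ⊕ f) = suc (pluses e + pluses f)
pluses (e ⊗ f) = pluses e + pluses f

T : ℕ → ℕ
T n = terms (dlsExpr n)

P : ℕ → ℕ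
P n = pluses (dlsExpr n)

module Submission where

open import Defs
open import Data.Nat using (ℕ; zero; suc; _+_; _∸_; _>_; s≤s)
open import Data.Nat.Properties using (+-identityʳ; +-comm; +-assoc)
open import Data.Product using (_×_; _,_)
open import Relation.Binary.PropositionalEquality
  using (_≡_; refl; sym; cong; cong₂; module ≡-Reasoning)

-- Both counts are additive over ⊕ and ⊗ and vanish on the constant 1, hence
-- additive over ⊛.  So the counts of E_i depend only on the distance d = n − i,
-- and E_i = (a_i a_{i+1} + b_i) E_{i+2} + a_i b_{i+1} E_{i+3} contributes
-- 3 + 2 terms and 1 + 1 pluses beyond those of E_{i+2} and E_{i+3}.

⊛-additive : (m : Expr → ℕ) → m one ≡ 0 → (∀ e f → m (e ⊗ f) ≡ m e + m f) →
             ∀ e f → m (e ⊛ f) ≡ m e + m f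
⊛-additive m m1 m⊗ one f rewrite m1 = refl
⊛-additive m m1 m⊗ (lab x) one rewrite m1 = sym (+-identityʳ _)
⊛-additive m m1 m⊗ (e ⊕ e′) one rewrite m1 = sym (+-identityʳ _)
⊛-additive m m1 m⊗ (e ⊗ e′) one rewrite m1 = sym (+-identityʳ _)
⊛-additive m m1 m⊗ (lab x) (lab y) = m⊗ _ _
⊛-additive m m1 m⊗ (lab x) (f ⊕ f′) = m⊗ _ _
⊛-additive m m1 m⊗ (lab x) (f ⊗ f′) = m⊗ _ _
⊛-additive m m1 m⊗ (e ⊕ e′) (lab y) = m⊗ _ _
⊛-additive m m1 m⊗ (e ⊕ e′) (f ⊕ f′) = m⊗ _ _
⊛-additive m m1 m⊗ (e ⊕ e′) (f ⊗ f′) = m⊗ _ _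
⊛-additive m m1 m⊗ (e ⊗ e′) (lab y) = m⊗ _ _
⊛-additive m m1 m⊗ (e ⊗ e′) (f ⊕ f′) = m⊗ _ _
⊛-additive m m1 m⊗ (e ⊗ e′) (f ⊗ f′) = m⊗ _ _

terms-⊛ : ∀ e f → terms (e ⊛ f) ≡ terms e + terms f
terms-⊛ = ⊛-additive terms refl (λ _ _ → refl)

pluses-⊛ : ∀ e f → pluses (e ⊛ f) ≡ pluses e + pluses f
pluses-⊛ = ⊛-additive pluses refl (λ _ _ → refl)

termsByDistance : ℕ → ℕ
termsByDistance zero = 0
termsByDistance (suc zero) = 1
termsByDistance (suc (suc zero)) = 3
termsByDistance (suc (suc (suc d))) =
  termsByDistance (suc d) + termsByDistance d + 5

plusesByDistance : ℕ → ℕ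
plusesByDistance zero = 0
plusesByDistance (suc zero) = 0
plusesByDistance (suc (suc zero)) = 1
plusesByDistance (suc (suc (suc d))) =
  plusesByDistance (suc d) + plusesByDistance d + 2

rearrange : ∀ k l x y → (k + x) + (l + y) ≡ x + y + (k + l)
rearrange k l x y = begin
  (k + x) + (l + y)   ≡⟨ cong₂ _+_ (+-comm k x) (+-comm l y) ⟩
  (x + k) + (y + l)   ≡⟨ +-assoc x k (y + l) ⟩
  x + (k + (y + l))   ≡⟨ cong (x +_) (sym (+-assoc k y l)) ⟩
  x + ((k + y) + l)   ≡⟨ cong (λ z → x + (z + l)) (+-comm k y) ⟩
  x + ((y + k) + l)   ≡⟨ cong (x +_) (+-assoc y k l) ⟩
  x + (y + (k + l))   ≡⟨ sym (+-assoc x y (k + l)) ⟩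
  x + y + (k + l)     ∎
  where open ≡-Reasoning

terms-dlsE : ∀ n d → terms (dlsE n d) ≡ termsByDistance d
terms-dlsE n zero = refl
terms-dlsE n (suc zero) = refl
terms-dlsE n (suc (suc zero)) = refl
terms-dlsE n (suc (suc (suc d))) = begin
  terms (left ⊛ dlsE n (suc d)) + terms (right ⊛ dlsE n d)
    ≡⟨ cong₂ _+_ (terms-⊛ left (dlsE n (suc d))) (terms-⊛ right (dlsE n d)) ⟩
  (3 + terms (dlsE n (suc d))) + (2 + terms (dlsE n d))
    ≡⟨ cong₂ (λ x y → (3 + x) + (2 + y)) (terms-dlsE n (suc d)) (terms-dlsE n d) ⟩
  (3 + termsByDistance (suc d)) + (2 + termsByDistance d)
    ≡⟨ rearrange 3 2 (termsByDistance (suc d)) (termsByDistance d) ⟩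
  termsByDistance (suc d) + termsByDistance d + 5 ∎
  where
  open ≡-Reasoning
  i = n ∸ suc (suc (suc d))
  left = (lab (a i) ⊛ lab (a (suc i))) ⊕ lab (b i)
  right = lab (a i) ⊛ lab (b (suc i))

pluses-dlsE : ∀ n d → pluses (dlsE n d) ≡ plusesByDistance d
pluses-dlsE n zero = refl
pluses-dlsE n (suc zero) = refl
pluses-dlsE n (suc (suc zero)) = refl
pluses-dlsE n (suc (suc (suc d))) = begin
  1 + (pluses (left ⊛ dlsE n (suc d)) + pluses (right ⊛ dlsE n d))
    ≡⟨ cong₂ (λ x y → 1 + (x + y)) (pluses-⊛ left (dlsE n (suc d))) (pluses-⊛ right (dlsE n d)) ⟩
  1 + ((1 + pluses (dlsE n (suc d))) + pluses (dlsE n d))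
    ≡⟨ cong₂ (λ x y → 1 + ((1 + x) + y)) (pluses-dlsE n (suc d)) (pluses-dlsE n d) ⟩
  1 + ((1 + plusesByDistance (suc d)) + plusesByDistance d)
    ≡⟨ +-comm 2 (plusesByDistance (suc d) + plusesByDistance d) ⟩
  plusesByDistance (suc d) + plusesByDistance d + 2 ∎
  where
  open ≡-Reasoning
  i = n ∸ suc (suc (suc d))
  left = (lab (a i) ⊛ lab (a (suc i))) ⊕ lab (b i)
  right = lab (a i) ⊛ lab (b (suc i))

theorem3 : (T 1 ≡ 0 × T 2 ≡ 1 × T 3 ≡ 3 × (∀ n → n > 3 → T n ≡ T (n ∸ 2) + T (n ∸ 3) + 5))
    × (P 1 ≡ 0 × P 2 ≡ 0 × P 3 ≡ 1 × (∀ n → n > 3 → P n ≡ P (n ∸ 2) + P (n ∸ 3) + 2))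
theorem3 = (refl , refl , refl , T-recurrence) , (refl , refl , refl , P-recurrence)
  where
  T-recurrence : ∀ n → n > 3 → T n ≡ T (n ∸ 2) + T (n ∸ 3) + 5
  T-recurrence n@(suc (suc (suc (suc k)))) (s≤s (s≤s (s≤s (s≤s _))))
    rewrite terms-dlsE n (3 + k) | terms-dlsE (2 + k) (1 + k) | terms-dlsE (1 + k) k = refl
  P-recurrence : ∀ n → n > 3 → P n ≡ P (n ∸ 2) + P (n ∸ 3) + 2
  P-recurrence n@(suc (suc (suc (suc k)))) (s≤s (s≤s (s≤s (s≤s _))))
    rewrite pluses-dlsE n (3 + k) | pluses-dlsE (2 + k) (1 + k) | pluses-dlsE (1 + k) k = refl
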